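{- For every integer $m>2$ there is an edge coloring of the complete graph on $2m$ vertices that contains a colorful $2m$-cycle but no colorful $(2m-1)$-cycle.
   Context: An $n$-cycle is a sequence $(v_1,\dots,v_n)$ of distinct vertices, with edges $v_iv_{i+1}$, indices mod $n$. A cycle is colorful if its edges have pairwise distinct colors. -}

module Defs where

open import Data.Nat using (ℕ; zero; suc; _≤_)
open import Data.Nat.DivMod using (_mod_)
open import Data.Fin using (Fin; toℕ)
open import Data.Product using (_×_)
open import Relation.Binary.PropositionalEquality using (_≡_)
open import Function.Definitions using (Injective)

-- An edge colouring of the complete graph K_n on vertex set Fin n with
-- colours in a type C: a colour for each pair of vertices, symmetric
-- (values on the diagonal are irrelevant: cycles never use loops).
record EdgeColoring (n : ℕ) (C : Set) : Set where
  field
    col  : Fin n → Fin n → C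
    symm : ∀ u v → col u v ≡ col v u
open EdgeColoring public

sucMod : ∀ {k} → Fin k → Fin k
sucMod {suc k} i = suc (toℕ i) mod suc k

-- A k-cycle in K_n: a sequence (v_0,…,v_{k-1}) of distinct vertices
-- (edges v_i v_{i+1 mod k}; in K_n all these edges exist), with k ≥ 3.
IsCycle : ∀ {n} (k : ℕ) → (Fin k → Fin n) → Set
IsCycle k v = (3 ≤ k) × Injective _≡_ _≡_ v

IsColorful : ∀ {n k C} → EdgeColoring n C → (Fin k → Fin n) → Set
IsColorful c v = Injective _≡_ _≡_ (λ i → col c (v i) (v (sucMod i)))

HasColorfulCycle : ∀ {n C} → EdgeColoring n C → ℕ → Set
HasColorfulCycle {n} c k =
  Data.Product.Σ (Fin k → Fin n) (λ v → IsCycle k v × IsColorful c v)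

module Submission where

-- Colour K_n (n ≥ 6) on the vertices 0, …, n−1 so that the edge {i, i+1} has colour i for
-- 2 ≤ i ≤ n−2, the edges from the apex 0 to the hubs 2 and n−1 have colour n−1, those from
-- the apex 1 to the hubs have colour 1, and all other edges have colour 0. Then 0, 1, …, n−1
-- is a colourful Hamiltonian cycle. A colourful (n−1)-cycle omits exactly one vertex w and,
-- using n−1 of the n colours, at most one colour; and an apex on it has one cycle edge of its
-- own colour, going to a hub, and one of colour 0. If w is interior to the path 2, …, n−1, the
-- colours w−1 and w are both omitted. If w is a hub, both apexes send their coloured edge to
-- the other hub x, leaving no room at x for its path edge, so both path colours at the hubs
-- are omitted. If w is an apex, let x be the hub avoided by the coloured edge of the other
-- apex: colour 0 and that apex colour are used elsewhere, so both cycle edges at x carry the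
-- same path colour.

open import Defs
open import Data.Nat using (ℕ; _<_; _*_; _∸_)
open import Data.Product using (Σ; _×_)
open import Relation.Nullary using (¬_)

open import Data.Bool using (if_then_else_)
open import Data.Empty using (⊥; ⊥-elim)
open import Data.Fin using (Fin; toℕ; fromℕ; inject₁) renaming (zero to fzero; suc to fsuc)
open import Data.Fin.Properties
  using (toℕ-injective; toℕ<n; toℕ-fromℕ; toℕ-fromℕ<; toℕ-inject₁; fromℕ<-injective;
         injective⇒≤; any?; ¬∀⟶∃¬)
  renaming (_≟_ to _≟ᶠ_)
open import Data.Nat using (zero; suc; _+_; _≤_; _⊓_; _⊔_; z≤n; s≤s; s≤s⁻¹; _≟_)
open import Data.Nat.DivMod using (_%_; m<n⇒m%n≡m; n%n≡0)
open import Data.Nat.Properties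
  using (suc-injective; ≤-refl; ≤-trans; ≤-total; n≤1+n; n<1+n; m≤n⇒m≤1+n; <-trans; ≤∧≢⇒<;
         m≤n⇒m<n∨m≡n; 1+n≰n; 1+n≢n; *-monoʳ-≤; ⊓-comm; ⊔-comm; m≤n⇒m⊓n≡m; m≤n⇒m⊔n≡n; m≥n⇒m⊓n≡n; m≥n⇒m⊔n≡m)
open import Data.Product using (_,_; proj₁; proj₂)
open import Data.Sum using (_⊎_; inj₁; inj₂)
open import Data.Vec.Functional using (_∷_)
open import Function using (_∘′_)
open import Function.Definitions using (Injective)
open import Relation.Nullary using (Dec; yes; no; does; contradiction)
open import Relation.Nullary.Decidable using (dec-true)
open import Relation.Binary.PropositionalEquality

sucMod-cases : ∀ {k} (i : Fin (suc k)) →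
  (toℕ i ≡ k × toℕ (sucMod i) ≡ 0) ⊎ (toℕ i < k × toℕ (sucMod i) ≡ suc (toℕ i))
sucMod-cases {k} i with m≤n⇒m<n∨m≡n (s≤s⁻¹ (toℕ<n i))
... | inj₁ i<k = inj₂ (i<k , trans (toℕ-fromℕ< _) (m<n⇒m%n≡m (s≤s i<k)))
... | inj₂ i≡k =
  inj₁ (i≡k , trans (toℕ-fromℕ< _) (trans (cong (λ x → suc x % suc k) i≡k) (n%n≡0 (suc k))))

sucMod-injective : ∀ {k} → Injective _≡_ _≡_ (sucMod {suc k})
sucMod-injective {_} {i} {j} eq with sucMod-cases i | sucMod-cases j
... | inj₁ (i≡k , _) | inj₁ (j≡k , _) = toℕ-injective (trans i≡k (sym j≡k))
... | inj₁ (_ , si≡0) | inj₂ (_ , sj≡1+j) with () ← trans (sym si≡0) (trans (cong toℕ eq) sj≡1+j)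
... | inj₂ (_ , si≡1+i) | inj₁ (_ , sj≡0) with () ← trans (sym sj≡0) (trans (cong toℕ (sym eq)) si≡1+i)
... | inj₂ (_ , si≡1+i) | inj₂ (_ , sj≡1+j) =
  toℕ-injective (suc-injective (trans (sym si≡1+i) (trans (cong toℕ eq) sj≡1+j)))

sucMod-≢ : ∀ {k} (i : Fin (suc (suc k))) → sucMod i ≢ i
sucMod-≢ i eq with sucMod-cases i
... | inj₁ (i≡k , si≡0) with () ← trans (sym i≡k) (trans (cong toℕ (sym eq)) si≡0)
... | inj₂ (_ , si≡1+i) = 1+n≢n (trans (sym si≡1+i) (cong toℕ eq))

predMod : ∀ {k} → Fin (suc k) → Fin (suc k)
predMod fzero    = fromℕ _
predMod (fsuc j) = inject₁ j

sucMod-predMod : ∀ {k} (j : Fin (suc k)) → sucMod (predMod j) ≡ j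
sucMod-predMod {k} fzero with sucMod-cases (fromℕ k)
... | inj₁ (_ , s≡0) = toℕ-injective s≡0
... | inj₂ (k<k , _) = contradiction (subst (_< k) (toℕ-fromℕ k) k<k) 1+n≰n
sucMod-predMod {suc k} (fsuc j) with sucMod-cases (inject₁ j)
... | inj₁ (j≡k , _) = contradiction (subst (_< suc k) (trans (sym (toℕ-inject₁ j)) j≡k) (toℕ<n j)) 1+n≰n
... | inj₂ (_ , s≡1+j) = toℕ-injective (trans s≡1+j (cong suc (toℕ-inject₁ j)))

predMod-≢ : ∀ {k} (j : Fin (suc (suc k))) → predMod j ≢ j
predMod-≢ j eq = sucMod-≢ (predMod j) (trans (sucMod-predMod j) (sym eq))

∷-injective : ∀ {k x} {f : Fin k → ℕ} →
  (∀ i → f i ≢ x) → Injective _≡_ _≡_ f → Injective _≡_ _≡_ (x ∷ f)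
∷-injective f≢x f-inj {fzero}  {fzero}  _  = refl
∷-injective f≢x f-inj {fzero}  {fsuc j} eq = contradiction (sym eq) (f≢x j)
∷-injective f≢x f-inj {fsuc i} {fzero}  eq = contradiction eq (f≢x i)
∷-injective f≢x f-inj {fsuc i} {fsuc j} eq = cong fsuc (f-inj eq)

bounded-injective⇒≤ : ∀ {k n} (f : Fin k → ℕ) →
  Injective _≡_ _≡_ f → (∀ i → f i < n) → k ≤ n
bounded-injective⇒≤ f f-inj f<n =
  injective⇒≤ (λ {i} {j} eq → f-inj (fromℕ<-injective (f i) (f j) (f<n i) (f<n j) eq))

bounded-injective-avoiding-two⇒2+≤ : ∀ {k n p q} (f : Fin k → ℕ) →
  Injective _≡_ _≡_ f → (∀ i → f i < n) → p < n → q < n → p ≢ q →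
  (∀ i → f i ≢ p) → (∀ i → f i ≢ q) → 2 + k ≤ n
bounded-injective-avoiding-two⇒2+≤ {p = p} {q} f f-inj f<n p<n q<n p≢q f≢p f≢q =
  bounded-injective⇒≤ (p ∷ q ∷ f) (∷-injective q∷f≢p (∷-injective f≢q f-inj)) bounded
  where
  q∷f≢p : ∀ i → (q ∷ f) i ≢ p
  q∷f≢p fzero    = p≢q ∘′ sym
  q∷f≢p (fsuc i) = f≢p i
  bounded : ∀ i → (p ∷ q ∷ f) i < _
  bounded fzero           = p<n
  bounded (fsuc fzero)    = q<n
  bounded (fsuc (fsuc i)) = f<n i

data OneOf (a b : ℕ) : ℕ → Set where
  left  : OneOf a b a
  right : OneOf a b b

oneOf? : ∀ a b x → Dec (OneOf a b x)
oneOf? a b x with x ≟ a | x ≟ b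
... | yes refl | _        = yes left
... | no _     | yes refl = yes right
... | no x≢a   | no x≢b   = no λ { left → x≢a refl ; right → x≢b refl }

OneOf-≢⇒≡ : ∀ {a b w x u} → OneOf a b w → OneOf a b x → OneOf a b u → w ≢ x → u ≢ w → u ≡ x
OneOf-≢⇒≡ left  left  _     w≢x _   = contradiction refl w≢x
OneOf-≢⇒≡ left  right left  _   u≢w = contradiction refl u≢w
OneOf-≢⇒≡ left  right right _   _   = refl
OneOf-≢⇒≡ right left  left  _   _   = refl
OneOf-≢⇒≡ right left  right _   u≢w = contradiction refl u≢w
OneOf-≢⇒≡ right right _     w≢x _   = contradiction refl w≢x

OneOf-other : ∀ {a b u} → a ≢ b → OneOf a b u → Σ ℕ λ x → OneOf a b x × x ≢ u
OneOf-other a≢b left  = _ , right , a≢b ∘′ sym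
OneOf-other a≢b right = _ , left , a≢b

onlyIf : {P : ℕ → Set} → (∀ x → Dec (P x)) → ℕ → ℕ → ℕ
onlyIf P? c x = if does (P? x) then c else 0

onlyIf-cases : ∀ {P : ℕ → Set} (P? : ∀ x → Dec (P x)) c x →
  (P x × onlyIf P? c x ≡ c) ⊎ onlyIf P? c x ≡ 0
onlyIf-cases P? c x with P? x
... | yes px = inj₁ (px , refl)
... | no _   = inj₂ refl

onlyIf-holds : ∀ {P : ℕ → Set} (P? : ∀ x → Dec (P x)) c {x} → P x → onlyIf P? c x ≡ c
onlyIf-holds P? c {x} px rewrite dec-true (P? x) px = refl

module ColourfulCycle
  {k n : ℕ} (col : ℕ → ℕ → ℕ) (col-sym : ∀ a b → col a b ≡ col b a)
  (v : Fin (2 + k) → Fin n) (v-inj : Injective _≡_ _≡_ v)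
  (colourful : Injective _≡_ _≡_ (λ q → col (toℕ (v q)) (toℕ (v (sucMod q)))))
  where

  Position : Set
  Position = Fin (2 + k)

  V : Position → ℕ
  V q = toℕ (v q)

  C : Position → ℕ
  C q = col (V q) (V (sucMod q))

  Touches : ℕ → Position → Set
  Touches z q = V q ≡ z ⊎ V (sucMod q) ≡ z

  Missing : ℕ → Set
  Missing w = ∀ q → V q ≢ w

  V-injective : Injective _≡_ _≡_ V
  V-injective eq = v-inj (toℕ-injective eq)

  missing-untouched : ∀ {w} → Missing w → ∀ q → ¬ Touches w q
  missing-untouched m q (inj₁ Vq≡w) = m q Vq≡w
  missing-untouched m q (inj₂ Vsq≡w) = m (sucMod q) Vsq≡w

  touched-< : ∀ {z q} → Touches z q → z < n
  touched-< {q = q} (inj₁ refl) = toℕ<n (v q)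
  touched-< {q = q} (inj₂ refl) = toℕ<n (v (sucMod q))

  touches-predMod : ∀ {z j} → V j ≡ z → Touches z (predMod j)
  touches-predMod {j = j} Vj≡z = inj₂ (trans (cong V (sucMod-predMod j)) Vj≡z)

  touching-positions : ∀ {z j q} → V j ≡ z → Touches z q → q ≡ j ⊎ q ≡ predMod j
  touching-positions {j = j} Vj≡z (inj₁ Vq≡z) = inj₁ (V-injective (trans Vq≡z (sym Vj≡z)))
  touching-positions {j = j} Vj≡z (inj₂ Vsq≡z) =
    inj₂ (sucMod-injective (trans (V-injective (trans Vsq≡z (sym Vj≡z))) (sym (sucMod-predMod j))))

  touches-at-most-two : ∀ {a b c q} → Touches a q → Touches b q → Touches c q →
    a ≢ b → a ≢ c → b ≢ c → ⊥
  touches-at-most-two (inj₁ x) (inj₁ y) _        a≢b _   _   = a≢b (trans (sym x) y)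
  touches-at-most-two (inj₂ x) (inj₂ y) _        a≢b _   _   = a≢b (trans (sym x) y)
  touches-at-most-two (inj₁ x) (inj₂ y) (inj₁ z) _   a≢c _   = a≢c (trans (sym x) z)
  touches-at-most-two (inj₁ x) (inj₂ y) (inj₂ z) _   _   b≢c = b≢c (trans (sym y) z)
  touches-at-most-two (inj₂ x) (inj₁ y) (inj₁ z) _   _   b≢c = b≢c (trans (sym y) z)
  touches-at-most-two (inj₂ x) (inj₁ y) (inj₂ z) _   a≢c _   = a≢c (trans (sym x) z)

  colour-between : ∀ {a b q} → Touches a q → Touches b q → a ≢ b → C q ≡ col a b
  colour-between (inj₁ x) (inj₁ y) a≢b = contradiction (trans (sym x) y) a≢b
  colour-between (inj₂ x) (inj₂ y) a≢b = contradiction (trans (sym x) y) a≢b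
  colour-between (inj₁ x) (inj₂ y) _   = cong₂ col x y
  colour-between {a} {b} (inj₂ x) (inj₁ y) _ = trans (cong₂ col y x) (col-sym b a)

  ends-differ : ∀ q → V q ≢ V (sucMod q)
  ends-differ q eq = sucMod-≢ q (sym (V-injective eq))

  other-end : ∀ {z q} → Touches z q → Σ ℕ λ t → Touches t q × t ≢ z × C q ≡ col z t
  other-end {q = q} z∈q@(inj₁ Vq≡z) =
    _ , inj₂ refl , (λ eq → ends-differ q (trans Vq≡z (sym eq))) ,
    colour-between z∈q (inj₂ refl) (λ eq → ends-differ q (trans Vq≡z eq))
  other-end {q = q} z∈q@(inj₂ Vsq≡z) =
    _ , inj₁ refl , (λ eq → ends-differ q (trans eq (sym Vsq≡z))) ,
    colour-between z∈q (inj₁ refl) (λ eq → ends-differ q (trans (sym eq) (sym Vsq≡z)))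

  ¬monochromatic-at : ∀ {z j} ρ → V j ≡ z → (∀ q → Touches z q → C q ≡ ρ) → ⊥
  ¬monochromatic-at {j = j} ρ Vj≡z mono =
    predMod-≢ j (colourful (trans (mono _ (touches-predMod Vj≡z)) (sym (mono j (inj₁ Vj≡z)))))

  ¬three-colours-at : ∀ {z j a b c} → V j ≡ z → Touches z a → Touches z b → Touches z c →
    C a ≢ C b → C a ≢ C c → C b ≢ C c → ⊥
  ¬three-colours-at Vj≡z z∈a z∈b z∈c ab ac bc
    with touching-positions Vj≡z z∈a | touching-positions Vj≡z z∈b | touching-positions Vj≡z z∈c
  ... | inj₁ refl | inj₁ refl | _         = ab refl
  ... | inj₂ refl | inj₂ refl | _         = ab refl
  ... | inj₁ refl | inj₂ refl | inj₁ refl = ac refl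
  ... | inj₁ refl | inj₂ refl | inj₂ refl = bc refl
  ... | inj₂ refl | inj₁ refl | inj₁ refl = bc refl
  ... | inj₂ refl | inj₁ refl | inj₂ refl = ac refl

≢-transport : ∀ {a b c d : ℕ} → a ≡ c → b ≡ d → c ≢ d → a ≢ b
≢-transport refl refl c≢d = c≢d

module Construction (e : ℕ) where

  n top : ℕ
  n   = 6 + e
  top = 5 + e

  IsApex IsHub : ℕ → Set
  IsApex = OneOf 0 1
  IsHub  = OneOf 2 top

  edgeColour : ℕ → ℕ → ℕ
  edgeColour zero          hi = onlyIf (oneOf? 2 top) top hi
  edgeColour (suc zero)    hi = onlyIf (oneOf? 2 top) 1 hi
  edgeColour (suc (suc l)) hi = onlyIf (_≟ 3 + l) (2 + l) hi

  colour : ℕ → ℕ → ℕ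
  colour a b = edgeColour (a ⊓ b) (a ⊔ b)

  apexColour : ∀ {s} → IsApex s → ℕ
  apexColour left  = top
  apexColour right = 1

  pathColour : ∀ {x} → IsHub x → ℕ
  pathColour left  = 2
  pathColour right = 4 + e

  apex-< : ∀ {s} → IsApex s → s < n
  apex-< left  = s≤s z≤n
  apex-< right = s≤s (s≤s z≤n)

  hub-< : ∀ {x} → IsHub x → x < n
  hub-< left  = s≤s (s≤s (s≤s z≤n))
  hub-< right = ≤-refl

  pathColour-< : ∀ {x} (hx : IsHub x) → pathColour hx < n
  pathColour-< left  = s≤s (s≤s (s≤s z≤n))
  pathColour-< right = n≤1+n top

  apex≢hub : ∀ {s x} → IsApex s → IsHub x → s ≢ x
  apex≢hub left  left  = λ ()
  apex≢hub left  right = λ ()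
  apex≢hub right left  = λ ()
  apex≢hub right right = λ ()

  apexColour≢0 : ∀ {s} (as : IsApex s) → apexColour as ≢ 0
  apexColour≢0 left  = λ ()
  apexColour≢0 right = λ ()

  pathColour≢apexColour : ∀ {x s} (hx : IsHub x) (as : IsApex s) → pathColour hx ≢ apexColour as
  pathColour≢apexColour left  left  = λ ()
  pathColour≢apexColour left  right = λ ()
  pathColour≢apexColour right left  = 1+n≢n ∘′ sym
  pathColour≢apexColour right right = λ ()

  pathColour-≢ : ∀ {w x} (hw : IsHub w) (hx : IsHub x) → w ≢ x → pathColour hw ≢ pathColour hx
  pathColour-≢ left  left  w≢x = contradiction refl w≢x
  pathColour-≢ left  right _   = λ ()
  pathColour-≢ right left  _   = λ ()
  pathColour-≢ right right w≢x = contradiction refl w≢x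

  colour-sym : ∀ a b → colour a b ≡ colour b a
  colour-sym a b = cong₂ edgeColour (⊓-comm a b) (⊔-comm a b)

  colour-≤ : ∀ {a b} → a ≤ b → colour a b ≡ edgeColour a b
  colour-≤ a≤b = cong₂ edgeColour (m≤n⇒m⊓n≡m a≤b) (m≤n⇒m⊔n≡n a≤b)

  colour-≥ : ∀ {a b} → b ≤ a → colour a b ≡ edgeColour b a
  colour-≥ b≤a = cong₂ edgeColour (m≥n⇒m⊓n≡n b≤a) (m≥n⇒m⊔n≡m b≤a)

  edgeColour-< : ∀ lo {hi} → hi < n → edgeColour lo hi < n
  edgeColour-< zero {hi} _ with onlyIf-cases (oneOf? 2 top) top hi
  ... | inj₁ (_ , c≡top) = subst (_< n) (sym c≡top) ≤-refl
  ... | inj₂ c≡0         = subst (_< n) (sym c≡0) (s≤s z≤n)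
  edgeColour-< (suc zero) {hi} _ with onlyIf-cases (oneOf? 2 top) 1 hi
  ... | inj₁ (_ , c≡1) = subst (_< n) (sym c≡1) (s≤s (s≤s z≤n))
  ... | inj₂ c≡0       = subst (_< n) (sym c≡0) (s≤s z≤n)
  edgeColour-< (suc (suc l)) {hi} hi<n with onlyIf-cases (_≟ 3 + l) (2 + l) hi
  ... | inj₁ (refl , c≡2+l) = subst (_< n) (sym c≡2+l) (≤-trans (n≤1+n (3 + l)) hi<n)
  ... | inj₂ c≡0            = subst (_< n) (sym c≡0) (s≤s z≤n)

  colour-< : ∀ {a b} → a < n → b < n → colour a b < n
  colour-< {a} {b} a<n b<n with ≤-total a b
  ... | inj₁ a≤b = subst (_< n) (sym (colour-≤ a≤b)) (edgeColour-< a b<n)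
  ... | inj₂ b≤a = subst (_< n) (sym (colour-≥ b≤a)) (edgeColour-< b a<n)

  colour-successor : ∀ i → colour i (suc i) ≡ i
  colour-successor zero with onlyIf-cases (oneOf? 2 top) top 1
  ... | inj₁ (() , _)
  ... | inj₂ c≡0 = c≡0
  colour-successor (suc zero)    = onlyIf-holds (oneOf? 2 top) 1 left
  colour-successor (suc (suc l)) = trans (colour-≤ (n≤1+n (2 + l))) (onlyIf-holds (_≟ 3 + l) (2 + l) refl)

  hamiltonian-colour : ∀ (i : Fin n) → colour (toℕ i) (toℕ (sucMod i)) ≡ toℕ i
  hamiltonian-colour i with sucMod-cases i
  ... | inj₁ (i≡top , si≡0) =
    trans (cong₂ colour i≡top si≡0) (trans (onlyIf-holds (oneOf? 2 top) top right) (sym i≡top))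
  ... | inj₂ (_ , si≡1+i) = trans (cong (colour (toℕ i)) si≡1+i) (colour-successor (toℕ i))

  apex-star : ∀ {s} (as : IsApex s) t → (IsHub t × colour s t ≡ apexColour as) ⊎ colour s t ≡ 0
  apex-star left  t = onlyIf-cases (oneOf? 2 top) top t
  apex-star right zero with onlyIf-cases (oneOf? 2 top) top 1
  ... | inj₁ (() , _)
  ... | inj₂ c≡0 = inj₂ c≡0
  apex-star right (suc t) = onlyIf-cases (oneOf? 2 top) 1 (suc t)

  apex-hub : ∀ {s x} (as : IsApex s) → IsHub x → colour s x ≡ apexColour as
  apex-hub left  hx    = onlyIf-holds (oneOf? 2 top) top hx
  apex-hub right left  = onlyIf-holds (oneOf? 2 top) 1 left
  apex-hub right right = onlyIf-holds (oneOf? 2 top) 1 right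

  edgeColour-path : ∀ {lo hi} l → l ≤ 2 + e → edgeColour lo hi ≡ 2 + l → lo ≡ 2 + l × hi ≡ 3 + l
  edgeColour-path {zero} {hi} l l≤2+e c≡2+l with onlyIf-cases (oneOf? 2 top) top hi
  ... | inj₁ (_ , c≡top) =
    contradiction (subst (_≤ 2 + e) (suc-injective (suc-injective (trans (sym c≡2+l) c≡top))) l≤2+e) 1+n≰n
  ... | inj₂ c≡0 with () ← trans (sym c≡0) c≡2+l
  edgeColour-path {suc zero} {hi} l _ c≡2+l with onlyIf-cases (oneOf? 2 top) 1 hi
  ... | inj₁ (_ , c≡1) with () ← trans (sym c≡1) c≡2+l
  ... | inj₂ c≡0       with () ← trans (sym c≡0) c≡2+l
  edgeColour-path {suc (suc l′)} {hi} l _ c≡2+l with onlyIf-cases (_≟ 3 + l′) (2 + l′) hi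
  ... | inj₁ (refl , c≡2+l′) with refl ← trans (sym c≡2+l′) c≡2+l = refl , refl
  ... | inj₂ c≡0 with () ← trans (sym c≡0) c≡2+l

  path-edge : ∀ {a b} l → l ≤ 2 + e → colour a b ≡ 2 + l →
    (a ≡ 2 + l × b ≡ 3 + l) ⊎ (b ≡ 2 + l × a ≡ 3 + l)
  path-edge {a} {b} l l≤2+e c≡2+l with ≤-total a b
  ... | inj₁ a≤b = inj₁ (edgeColour-path l l≤2+e (trans (sym (colour-≤ a≤b)) c≡2+l))
  ... | inj₂ b≤a = inj₂ (edgeColour-path l l≤2+e (trans (sym (colour-≥ b≤a)) c≡2+l))

  hub-star : ∀ {x} (hx : IsHub x) t → t < n →
    IsApex t ⊎ colour x t ≡ pathColour hx ⊎ colour x t ≡ 0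
  hub-star _ zero       _ = inj₁ left
  hub-star _ (suc zero) _ = inj₁ right
  hub-star left (suc (suc t)) _ with onlyIf-cases (_≟ 3) 2 (2 + t)
  ... | inj₁ (_ , c≡2) = inj₂ (inj₁ c≡2)
  ... | inj₂ c≡0       = inj₂ (inj₂ c≡0)
  hub-star right (suc (suc t)) t<n with onlyIf-cases (_≟ 3 + t) (2 + t) top
  ... | inj₁ (top≡3+t , c≡2+t) =
    inj₂ (inj₁ (trans (colour-≥ (s≤s⁻¹ t<n)) (trans c≡2+t (sym (suc-injective top≡3+t)))))
  ... | inj₂ c≡0 = inj₂ (inj₂ (trans (colour-≥ (s≤s⁻¹ t<n)) c≡0))

  vertex-kinds : ∀ {w} → w < n → IsApex w ⊎ IsHub w ⊎ Σ ℕ λ l → w ≡ 3 + l × l ≤ 1 + e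
  vertex-kinds {zero}       _ = inj₁ left
  vertex-kinds {suc zero}   _ = inj₁ right
  vertex-kinds {suc (suc zero)} _ = inj₂ (inj₁ left)
  vertex-kinds {suc (suc (suc l))} 3+l<n with l ≟ 2 + e
  ... | yes refl = inj₂ (inj₁ right)
  ... | no l≢2+e = inj₂ (inj₂ (l , refl , s≤s⁻¹ (≤∧≢⇒< (s≤s⁻¹ (s≤s⁻¹ (s≤s⁻¹ (s≤s⁻¹ 3+l<n)))) l≢2+e)))

  module ShortCycle (v : Fin (5 + e) → Fin n) (v-inj : Injective _≡_ _≡_ v)
    (colourful : Injective _≡_ _≡_ (λ q → colour (toℕ (v q)) (toℕ (v (sucMod q)))))
    where
    open ColourfulCycle colour colour-sym v v-inj colourful

    ¬avoiding-two : ∀ {p q} (f : Position → ℕ) → Injective _≡_ _≡_ f → (∀ i → f i < n) →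
      p < n → q < n → p ≢ q → (∀ i → f i ≢ p) → (∀ i → f i ≢ q) → ⊥
    ¬avoiding-two f f-inj f<n p<n q<n p≢q f≢p f≢q =
      1+n≰n (bounded-injective-avoiding-two⇒2+≤ f f-inj f<n p<n q<n p≢q f≢p f≢q)

    ¬two-missing-colours : ∀ {c c′} → c < n → c′ < n → c ≢ c′ →
      (∀ q → C q ≢ c) → (∀ q → C q ≢ c′) → ⊥
    ¬two-missing-colours = ¬avoiding-two C colourful (λ q → colour-< (toℕ<n (v q)) (toℕ<n (v (sucMod q))))

    missing-vertex : Σ ℕ λ w → w < n × Missing w
    missing-vertex with ¬∀⟶∃¬ n (λ z → Σ Position λ j → v j ≡ z) (λ z → any? λ j → v j ≟ᶠ z) not-onto
      where
      not-onto : ¬ (∀ z → Σ Position λ j → v j ≡ z)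
      not-onto onto = 1+n≰n (injective⇒≤ {f = λ z → proj₁ (onto z)}
        (λ {a} {b} eq → trans (sym (proj₂ (onto a))) (trans (cong v eq) (proj₂ (onto b)))))
    ... | z , z∉v = toℕ z , toℕ<n z , λ q Vq≡z → z∉v (q , toℕ-injective Vq≡z)

    path-colour-touches : ∀ {q} l → l ≤ 2 + e → C q ≡ 2 + l → Touches (2 + l) q × Touches (3 + l) q
    path-colour-touches l l≤2+e Cq≡2+l with path-edge l l≤2+e Cq≡2+l
    ... | inj₁ (a≡2+l , b≡3+l) = inj₁ a≡2+l , inj₂ b≡3+l
    ... | inj₂ (b≡2+l , a≡3+l) = inj₂ b≡2+l , inj₁ a≡3+l

    hub-colour-touches : ∀ {x q} (hx : IsHub x) → C q ≡ pathColour hx → Touches x q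
    hub-colour-touches left  Cq≡2   = proj₁ (path-colour-touches 0 z≤n Cq≡2)
    hub-colour-touches right Cq≡4+e = proj₂ (path-colour-touches (2 + e) ≤-refl Cq≡4+e)

    record ApexSplit {s} (as : IsApex s) : Set where
      field
        hub           : ℕ
        hub-isHub     : IsHub hub
        coloured      : Position
        coloured-apex : Touches s coloured
        coloured-hub  : Touches hub coloured
        coloured-col  : C coloured ≡ apexColour as
        blank         : Position
        blank-apex    : Touches s blank
        blank-col     : C blank ≡ 0

    apex-split : ∀ {s j} (as : IsApex s) → V j ≡ s → ApexSplit as
    apex-split {j = j} as Vj≡s with other-end (inj₁ Vj≡s) | other-end (touches-predMod Vj≡s)
    ... | t , t∈j , _ , Cj≡ | t′ , t′∈p , _ , Cp≡ with apex-star as t | apex-star as t′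
    ... | inj₁ (ht , c) | inj₂ c′ =
      record { hub = t ; hub-isHub = ht ; coloured = j ; coloured-apex = inj₁ Vj≡s ; coloured-hub = t∈j
             ; coloured-col = trans Cj≡ c ; blank = predMod j ; blank-apex = touches-predMod Vj≡s
             ; blank-col = trans Cp≡ c′ }
    ... | inj₂ c | inj₁ (ht′ , c′) =
      record { hub = t′ ; hub-isHub = ht′ ; coloured = predMod j ; coloured-apex = touches-predMod Vj≡s
             ; coloured-hub = t′∈p ; coloured-col = trans Cp≡ c′ ; blank = j ; blank-apex = inj₁ Vj≡s
             ; blank-col = trans Cj≡ c }
    ... | inj₁ (_ , c) | inj₁ (_ , c′) = ⊥-elim (predMod-≢ j (colourful (trans (trans Cp≡ c′) (sym (trans Cj≡ c)))))
    ... | inj₂ c | inj₂ c′ = ⊥-elim (predMod-≢ j (colourful (trans (trans Cp≡ c′) (sym (trans Cj≡ c)))))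

    module _ {w} (w<n : w < n) (w-missing : Missing w) where

      occurs : ∀ {z} → z < n → z ≢ w → Σ Position λ j → V j ≡ z
      occurs {z} z<n z≢w with any? (λ j → V j ≟ z)
      ... | yes z∈v = z∈v
      ... | no z∉v = ⊥-elim (¬avoiding-two V V-injective (λ q → toℕ<n (v q)) w<n z<n (z≢w ∘′ sym)
                               w-missing (λ q Vq≡z → z∉v (q , Vq≡z)))

      touched≢missing : ∀ {t q} → Touches t q → t ≢ w
      touched≢missing {q = q} t∈q t≡w = missing-untouched w-missing q (subst (λ z → Touches z q) t≡w t∈q)

      interior-missing : ∀ l → w ≡ 3 + l → l ≤ 1 + e → ⊥
      interior-missing l w≡3+l l≤1+e =
        ¬two-missing-colours (<-trans (n<1+n (2 + l)) 3+l<n) 3+l<n (1+n≢n ∘′ sym)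
          (λ q Cq≡2+l → touched≢missing (proj₂ (path-colour-touches l (m≤n⇒m≤1+n l≤1+e) Cq≡2+l)) (sym w≡3+l))
          (λ q Cq≡3+l → touched≢missing (proj₁ (path-colour-touches (suc l) (s≤s l≤1+e) Cq≡3+l)) (sym w≡3+l))
        where
        3+l<n : 3 + l < n
        3+l<n = subst (_< n) w≡3+l w<n

      coloured-edge-to-other-hub : ∀ {x s} (hw : IsHub w) (hx : IsHub x) → w ≢ x → (as : IsApex s) →
        Σ Position λ P → Touches x P × C P ≡ apexColour as
      coloured-edge-to-other-hub {x} hw hx w≢x as =
        coloured , subst (λ z → Touches z coloured) hub≡x coloured-hub , coloured-col
        where
        open ApexSplit (apex-split as (proj₂ (occurs (apex-< as) (apex≢hub as hw))))
        hub≡x : hub ≡ x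
        hub≡x = OneOf-≢⇒≡ hw hx hub-isHub w≢x (touched≢missing coloured-hub)

      hub-missing : ∀ {x} (hw : IsHub w) (hx : IsHub x) → w ≢ x → ⊥
      hub-missing {x} hw hx w≢x =
        ¬two-missing-colours (pathColour-< hw) (pathColour-< hx) (pathColour-≢ hw hx w≢x)
          (λ q Cq≡ → touched≢missing (hub-colour-touches hw Cq≡) refl)
          (λ q Cq≡ → no-third-edge-at-x (coloured-edge-to-other-hub hw hx w≢x left)
                          (coloured-edge-to-other-hub hw hx w≢x right) (hub-colour-touches hx Cq≡) Cq≡)
        where
        no-third-edge-at-x : ∀ {q} →
          Σ Position (λ P → Touches x P × C P ≡ top) → Σ Position (λ P → Touches x P × C P ≡ 1) →
          Touches x q → C q ≡ pathColour hx → ⊥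
        no-third-edge-at-x (P₀ , x∈P₀ , CP₀≡top) (P₁ , x∈P₁ , CP₁≡1) x∈q Cq≡ =
          ¬three-colours-at (proj₂ (occurs (hub-< hx) (w≢x ∘′ sym))) x∈P₀ x∈P₁ x∈q
            (≢-transport CP₀≡top CP₁≡1 λ ())
            (≢-transport CP₀≡top Cq≡ (pathColour≢apexColour hx left ∘′ sym))
            (≢-transport CP₁≡1 Cq≡ (pathColour≢apexColour hx right ∘′ sym))

      module _ {s} (aw : IsApex w) (as : IsApex s) (w≢s : w ≢ s) (split : ApexSplit as) where
        open ApexSplit split

        path-coloured-at-avoided-hub : ∀ {x} (hx : IsHub x) → x ≢ hub →
          ∀ q → Touches x q → C q ≡ pathColour hx
        path-coloured-at-avoided-hub {x} hx x≢hub q x∈q with other-end x∈q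
        ... | t , t∈q , _ , Cq≡ with hub-star hx t (touched-< t∈q)
        ... | inj₂ (inj₁ c) = trans Cq≡ c
        ... | inj₁ at
          with refl ← OneOf-≢⇒≡ aw as at w≢s (touched≢missing t∈q)
          with refl ← colourful (trans Cq≡ (trans (colour-sym x s) (trans (apex-hub as hx) (sym coloured-col))))
          = ⊥-elim (touches-at-most-two coloured-apex coloured-hub x∈q
                     (apex≢hub as hub-isHub) (apex≢hub as hx) (x≢hub ∘′ sym))
        ... | inj₂ (inj₂ c) with refl ← colourful (trans (trans Cq≡ c) (sym blank-col))
          = ⊥-elim (apexColour≢0 as (begin
              apexColour as   ≡⟨ sym (apex-hub as hx) ⟩
              colour s x      ≡⟨ sym (colour-between blank-apex x∈q (apex≢hub as hx)) ⟩
              C blank         ≡⟨ blank-col ⟩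
              0               ∎))
          where open ≡-Reasoning

      apex-missing : ∀ {s} (aw : IsApex w) (as : IsApex s) → w ≢ s → ⊥
      apex-missing aw as w≢s with apex-split as (proj₂ (occurs (apex-< as) (w≢s ∘′ sym)))
      ... | split with OneOf-other (λ ()) (ApexSplit.hub-isHub split)
      ... | x , hx , x≢hub =
        ¬monochromatic-at (pathColour hx) (proj₂ (occurs (hub-< hx) (apex≢hub aw hx ∘′ sym)))
          (path-coloured-at-avoided-hub aw as w≢s split hx x≢hub)

    missing-vertex-impossible : ∀ {w} → w < n → Missing w →
      IsApex w ⊎ IsHub w ⊎ Σ ℕ (λ l → w ≡ 3 + l × l ≤ 1 + e) → ⊥
    missing-vertex-impossible w<n w-missing (inj₁ left)         = apex-missing w<n w-missing left right (λ ())
    missing-vertex-impossible w<n w-missing (inj₁ right)        = apex-missing w<n w-missing right left (λ ())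
    missing-vertex-impossible w<n w-missing (inj₂ (inj₁ left))  = hub-missing w<n w-missing left right (λ ())
    missing-vertex-impossible w<n w-missing (inj₂ (inj₁ right)) = hub-missing w<n w-missing right left (λ ())
    missing-vertex-impossible w<n w-missing (inj₂ (inj₂ (l , w≡3+l , l≤1+e))) =
      interior-missing w<n w-missing l w≡3+l l≤1+e

    no-colourful-short-cycle : ⊥
    no-colourful-short-cycle =
      let w , w<n , w-missing = missing-vertex in missing-vertex-impossible w<n w-missing (vertex-kinds w<n)

  colouring : EdgeColoring n ℕ
  colouring = record { col = λ a b → colour (toℕ a) (toℕ b) ; symm = λ a b → colour-sym (toℕ a) (toℕ b) }

  hamiltonian : HasColorfulCycle colouring n
  hamiltonian = (λ i → i) , (s≤s (s≤s (s≤s z≤n)) , λ eq → eq) ,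
    λ {i} {j} eq → toℕ-injective (trans (sym (hamiltonian-colour i)) (trans eq (hamiltonian-colour j)))

  no-short-cycle : ¬ HasColorfulCycle colouring (n ∸ 1)
  no-short-cycle (v , (_ , v-inj) , colourful) = ShortCycle.no-colourful-short-cycle v v-inj colourful

colourful-hamiltonian-without-shorter : ∀ n → 6 ≤ n →
  Σ (EdgeColoring n ℕ) λ c → HasColorfulCycle c n × ¬ HasColorfulCycle c (n ∸ 1)
colourful-hamiltonian-without-shorter (suc (suc (suc (suc (suc (suc e)))))) (s≤s (s≤s (s≤s (s≤s (s≤s (s≤s _)))))) =
  colouring , hamiltonian , no-short-cycle
  where open Construction e

mainTheorem6 : (m : ℕ) → 2 < m →
    Σ (EdgeColoring (2 * m) ℕ) (λ c →
      HasColorfulCycle c (2 * m) × ¬ HasColorfulCycle c (2 * m ∸ 1))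
mainTheorem6 m 2<m = colourful-hamiltonian-without-shorter (2 * m) (*-monoʳ-≤ 2 2<m)
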